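{- Let $t\ge 2$ be an integer. For every poset $P$ with finite cardinality $n$, $\operatorname{ldim}_t(P)\ge \log_t n$.
   Context: All posets are nonempty. For an integer $t\ge2$, $\mathbf{t}$ denotes the $t$-element chain. A partial function $f$ from a poset $P$ to a chain is monotone if $x\le y$ with $x,y\in\operatorname{dom}(f)$ implies $f(x)\le f(y)$. A local $t$-realiser of $P$ is a set $\mathcal{R}$ of monotone partial functions from $P$ to $\mathbf{t}$ such that for all $x,y\in P$ with $x\not\ge y$ there is $f\in\mathcal{R}$ with $x,y\in\operatorname{dom}(f)$ and $f(x)<f(y)$. The multiplicity $\mu_{\mathcal{R}}(x)$ of $x\in P$ is the number of $f\in\mathcal{R}$ with $x\in\operatorname{dom}(f)$. The local $t$-dimension $\operatorname{ldim}_t(P)$ is the minimum over all local $t$-realisers $\mathcal{R}$ of $P$ of $\max\{\mu_{\mathcal{R}}(x): x\in P\}$. -}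

module Defs where

open import Level using (Level)
open import Data.Nat using (ℕ; zero; suc)
open import Data.Fin using (Fin) renaming (_≤_ to _≤ᶠ_; _<_ to _<ᶠ_)
open import Data.Maybe using (Maybe; just; nothing)
open import Data.List using (List; []; _∷_)
open import Data.List.Membership.Propositional using (_∈_)
open import Data.Product using (Σ; _×_; ∃; ∃-syntax)
open import Relation.Binary.PropositionalEquality using (_≡_)
open import Relation.Nullary using (¬_)

PartialFun : ∀ {a} → Set a → ℕ → Set a
PartialFun A t = A → Maybe (Fin t)

Monotone : ∀ {a r} {A : Set a} {t : ℕ} → (A → A → Set r) → PartialFun A t → Set (a Level.⊔ r)
Monotone {A = A} {t} _≤_ f =
  ∀ {x y : A} {i j : Fin t} → x ≤ y → f x ≡ just i → f y ≡ just j → i ≤ᶠ j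

IsLocalRealiser : ∀ {a r} {A : Set a} {t : ℕ} → (A → A → Set r) → List (PartialFun A t) → Set (a Level.⊔ r)
IsLocalRealiser {A = A} {t} _≤_ R =
  (∀ {f} → f ∈ R → Monotone _≤_ f) ×
  (∀ (x y : A) → ¬ (y ≤ x) →
     ∃[ f ] (f ∈ R × ∃[ i ] ∃[ j ] (f x ≡ just i × f y ≡ just j × i <ᶠ j)))

multiplicity : ∀ {a} {A : Set a} {t : ℕ} → List (PartialFun A t) → A → ℕ
multiplicity [] x = zero
multiplicity (f ∷ R) x with f x
... | just _  = suc (multiplicity R x)
... | nothing = multiplicity R x

module Submission where

-- Record each point x by its profile (f x) for f ∈ R, a partial word of length m = |R| over
-- t letters with at most k defined letters. The realiser separates every pair x ≱ y, so by
-- antisymmetry distinct points have conflicting profiles: some coordinate is defined in both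
-- and differs. The complete words extending a partial word with at most k defined letters
-- number at least t^(m-k), and those extending conflicting partial words are disjoint
-- (Kraft's inequality), so n · t^(m-k) ≤ t^m.

open import Defs
open import Level using (Level)
open import Data.Nat using (ℕ; zero; suc; _+_; _*_; _^_; _≤_; z≤n; s≤s; NonZero)
open import Data.Nat.Properties
  using (≤-refl; ≤-trans; ≤-reflexive; +-mono-≤; *-monoʳ-≤; *-monoˡ-≤; ^-monoʳ-≤; m≤m+n; m≤n+m;
         +-suc; *-distribʳ-+; *-comm; *-cancelʳ-≤; m^n≢0; ^-distribˡ-+-*; +-0-commutativeMonoid;
         module ≤-Reasoning)
open import Data.Nat.ListAction using (sum)
open import Algebra.Properties.CommutativeMonoid.Sum +-0-commutativeMonoid
  using (sum-syntax; ∑-distrib-+; sum-cong-≗)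
open import Data.Fin using (Fin; zero; suc; _≟_)
open import Data.Fin.Properties using (<⇒≢)
open import Data.Maybe using (Maybe; just; nothing)
open import Data.Vec using (Vec; []; _∷_)
open import Data.List using (List; []; _∷_; map; length; tabulate)
open import Data.List.Properties using (length-tabulate)
open import Data.List.Membership.Propositional using (_∈_)
open import Data.List.Relation.Unary.Any using (here; there)
open import Data.List.Relation.Unary.All as All using (All; []; _∷_)
open import Data.List.Relation.Unary.All.Properties using (tabulate⁺)
open import Data.List.Relation.Unary.AllPairs using (AllPairs; []; _∷_)
import Data.List.Relation.Unary.AllPairs.Properties as AllPairs
open import Data.Product using (_,_; proj₂)
open import Data.Empty using (⊥-elim)
open import Function using (_∘_)
open import Relation.Nullary using (¬_; Dec; yes; no; contradiction)
open import Relation.Binary.PropositionalEquality using (_≡_; _≢_; refl; sym; trans; cong)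
open import Relation.Binary.Definitions using (Antisymmetric)
open import Relation.Binary.Structures using (IsPartialOrder)

∑-const : ∀ n c → ∑[ i < n ] c ≡ n * c
∑-const zero    c = refl
∑-const (suc n) c = cong (c +_) (∑-const n c)

∑-mono-≤ : ∀ {n} {f g : Fin n → ℕ} → (∀ i → f i ≤ g i) → ∑[ i < n ] f i ≤ ∑[ i < n ] g i
∑-mono-≤ {zero}  f≤g = z≤n
∑-mono-≤ {suc n} f≤g = +-mono-≤ (f≤g zero) (∑-mono-≤ (f≤g ∘ suc))

≤-∑ : ∀ {n} (f : Fin n → ℕ) i → f i ≤ ∑[ j < n ] f j
≤-∑ f zero    = m≤m+n _ _
≤-∑ f (suc i) = ≤-trans (≤-∑ (f ∘ suc) i) (m≤n+m _ _)

length*≤sum* : ∀ {A : Set} {a b} (g : A → ℕ) {L : List A} →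
               All (λ x → a ≤ g x * b) L → length L * a ≤ sum (map g L) * b
length*≤sum* g []                   = z≤n
length*≤sum* {a = a} {b} g {x ∷ L} (a≤gxb ∷ a≤gLb) = begin
  a + length L * a            ≤⟨ +-mono-≤ a≤gxb (length*≤sum* g a≤gLb) ⟩
  g x * b + sum (map g L) * b ≡⟨ *-distribʳ-+ b (g x) _ ⟨
  sum (map g (x ∷ L)) * b     ∎
  where open ≤-Reasoning

module PartialWords (t : ℕ) where

  PartialWord : ℕ → Set
  PartialWord = Vec (Maybe (Fin t))

  data Conflict : ∀ {m} → PartialWord m → PartialWord m → Set where
    here  : ∀ {m i j} {u v : PartialWord m} → i ≢ j → Conflict (just i ∷ u) (just j ∷ v)
    there : ∀ {m a b} {u v : PartialWord m} → Conflict u v → Conflict (a ∷ u) (b ∷ v)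

  Conflict-sym : ∀ {m} {u v : PartialWord m} → Conflict u v → Conflict v u
  Conflict-sym (here i≢j) = here (i≢j ∘ sym)
  Conflict-sym (there c)  = there (Conflict-sym c)

  conflict? : ∀ {m} (u v : PartialWord m) → Dec (Conflict u v)
  conflict? [] [] = no λ ()
  conflict? (a ∷ u) (b ∷ v) with conflict? u v
  ... | yes c = yes (there c)
  ... | no ¬c = head-conflict? a b
    where
    head-conflict? : ∀ a b → Dec (Conflict (a ∷ u) (b ∷ v))
    head-conflict? (just i) (just j) with i ≟ j
    ... | yes i≡j = no λ { (here i≢j) → i≢j i≡j ; (there c) → ¬c c }
    ... | no  i≢j = yes (here i≢j)
    head-conflict? (just i) nothing = no λ { (there c) → ¬c c }
    head-conflict? nothing  b       = no λ { (there c) → ¬c c }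

  holes defined : ∀ {m} → PartialWord m → ℕ
  holes []            = 0
  holes (nothing ∷ v) = suc (holes v)
  holes (just _ ∷ v)  = holes v
  defined []            = 0
  defined (nothing ∷ v) = defined v
  defined (just _ ∷ v)  = suc (defined v)

  holes+defined : ∀ {m} (v : PartialWord m) → holes v + defined v ≡ m
  holes+defined []            = refl
  holes+defined (nothing ∷ v) = cong suc (holes+defined v)
  holes+defined (just _ ∷ v)  = trans (+-suc (holes v) _) (cong suc (holes+defined v))

  -- The number of complete words extending v.
  weight : ∀ {m} → PartialWord m → ℕ
  weight v = t ^ holes v

  data Compatible (i : Fin t) : Maybe (Fin t) → Set where
    undefined : Compatible i nothing
    agrees    : Compatible i (just i)

  compatible? : ∀ i a → Dec (Compatible i a)
  compatible? i nothing = yes undefined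
  compatible? i (just j) with j ≟ i
  ... | yes refl = yes agrees
  ... | no  j≢i  = no λ { agrees → j≢i refl }

  restrict : ∀ {m} → Fin t → List (PartialWord (suc m)) → List (PartialWord m)
  restrict i [] = []
  restrict i ((a ∷ v) ∷ L) with compatible? i a
  ... | yes _ = v ∷ restrict i L
  ... | no  _ = restrict i L

  Conflict-tail : ∀ {m i a b} {u v : PartialWord m} →
                  Compatible i a → Compatible i b → Conflict (a ∷ u) (b ∷ v) → Conflict u v
  Conflict-tail agrees agrees (here i≢i) = contradiction refl i≢i
  Conflict-tail _      _      (there c)  = c

  restrict⁺-All : ∀ {m i a} {u : PartialWord m} {L} → Compatible i a →
                  All (Conflict (a ∷ u)) L → All (Conflict u) (restrict i L)
  restrict⁺-All ca [] = []
  restrict⁺-All {i = i} {L = (b ∷ v) ∷ L} ca (c ∷ cs) with compatible? i b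
  ... | yes cb = Conflict-tail ca cb c ∷ restrict⁺-All ca cs
  ... | no  _  = restrict⁺-All ca cs

  restrict⁺-AllPairs : ∀ {m} i {L : List (PartialWord (suc m))} →
                       AllPairs Conflict L → AllPairs Conflict (restrict i L)
  restrict⁺-AllPairs i [] = []
  restrict⁺-AllPairs i {(a ∷ v) ∷ L} (cs ∷ ps) with compatible? i a
  ... | yes ca = restrict⁺-All ca cs ∷ restrict⁺-AllPairs i ps
  ... | no  _  = restrict⁺-AllPairs i ps

  weightAt : ∀ {m} → Fin t → PartialWord (suc m) → ℕ
  weightAt i (a ∷ v) with compatible? i a
  ... | yes _ = weight v
  ... | no  _ = 0

  weightAt-agrees : ∀ {m} j (v : PartialWord m) → weightAt j (just j ∷ v) ≡ weight v
  weightAt-agrees j v with compatible? j (just j)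
  ... | yes _  = refl
  ... | no  ¬c = contradiction agrees ¬c

  weight≤∑weightAt : ∀ {m} (w : PartialWord (suc m)) → weight w ≤ ∑[ i < t ] weightAt i w
  weight≤∑weightAt (nothing ∷ v) = ≤-reflexive (sym (∑-const t (weight v)))
  weight≤∑weightAt (just j ∷ v)  = begin
    weight v                       ≡⟨ weightAt-agrees j v ⟨
    weightAt j (just j ∷ v)        ≤⟨ ≤-∑ (λ i → weightAt i (just j ∷ v)) j ⟩
    ∑[ i < t ] weightAt i (just j ∷ v) ∎
    where open ≤-Reasoning

  sum-restrict-∷ : ∀ {m} i (w : PartialWord (suc m)) L →
    sum (map weight (restrict i (w ∷ L))) ≡ weightAt i w + sum (map weight (restrict i L))
  sum-restrict-∷ i (a ∷ v) L with compatible? i a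
  ... | yes _ = refl
  ... | no  _ = refl

  sum-weight≤∑restrict : ∀ {m} (L : List (PartialWord (suc m))) →
    sum (map weight L) ≤ ∑[ i < t ] sum (map weight (restrict i L))
  sum-weight≤∑restrict []      = z≤n
  sum-weight≤∑restrict (w ∷ L) = begin
    weight w + sum (map weight L)
      ≤⟨ +-mono-≤ (weight≤∑weightAt w) (sum-weight≤∑restrict L) ⟩
    ∑[ i < t ] weightAt i w + ∑[ i < t ] sum (map weight (restrict i L))
      ≡⟨ ∑-distrib-+ (λ i → weightAt i w) (λ i → sum (map weight (restrict i L))) ⟨
    ∑[ i < t ] (weightAt i w + sum (map weight (restrict i L)))
      ≡⟨ sum-cong-≗ (λ i → sum-restrict-∷ i w L) ⟨
    ∑[ i < t ] sum (map weight (restrict i (w ∷ L))) ∎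
    where open ≤-Reasoning

  -- Kraft's inequality: conflicting partial words have disjoint sets of completions.
  kraft : ∀ m (L : List (PartialWord m)) → AllPairs Conflict L → sum (map weight L) ≤ t ^ m
  kraft zero    []             _                 = z≤n
  kraft zero    ([] ∷ [])      _                 = ≤-refl
  kraft zero    ([] ∷ [] ∷ _)  ((() ∷ _) ∷ _)
  kraft (suc m) L              ps                = begin
    sum (map weight L)                             ≤⟨ sum-weight≤∑restrict L ⟩
    ∑[ i < t ] sum (map weight (restrict i L))     ≤⟨ ∑-mono-≤ (λ i → kraft m (restrict i L) (restrict⁺-AllPairs i ps)) ⟩
    ∑[ i < t ] (t ^ m)                             ≡⟨ ∑-const t (t ^ m) ⟩
    t ^ suc m                                      ∎
    where open ≤-Reasoning

  t^m≤weight*t^k : ∀ {m k} .{{_ : NonZero t}} (v : PartialWord m) → defined v ≤ k →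
                   t ^ m ≤ weight v * t ^ k
  t^m≤weight*t^k {m} {k} v defined≤k = begin
    t ^ m                         ≡⟨ cong (t ^_) (holes+defined v) ⟨
    t ^ (holes v + defined v)     ≡⟨ ^-distribˡ-+-* t (holes v) (defined v) ⟩
    weight v * t ^ defined v      ≤⟨ *-monoʳ-≤ (weight v) (^-monoʳ-≤ t defined≤k) ⟩
    weight v * t ^ k              ∎
    where open ≤-Reasoning

  length≤t^k : ∀ {m k} .{{_ : NonZero t}} (L : List (PartialWord m)) →
               AllPairs Conflict L → All (λ v → defined v ≤ k) L → length L ≤ t ^ k
  length≤t^k {m} {k} L ps defined≤k = *-cancelʳ-≤ (length L) (t ^ k) (t ^ m) {{m^n≢0 t m}} (begin
    length L * t ^ m              ≤⟨ length*≤sum* weight (All.map (λ {v} → t^m≤weight*t^k v) defined≤k) ⟩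
    sum (map weight L) * t ^ k    ≤⟨ *-monoˡ-≤ (t ^ k) (kraft m L ps) ⟩
    t ^ m * t ^ k                 ≡⟨ *-comm (t ^ m) (t ^ k) ⟩
    t ^ k * t ^ m                 ∎)
    where open ≤-Reasoning

open PartialWords

profile : ∀ {a} {A : Set a} {t} (R : List (PartialFun A t)) → A → PartialWord t (length R)
profile []      x = []
profile (f ∷ R) x = f x ∷ profile R x

defined-profile : ∀ {a} {A : Set a} {t} (R : List (PartialFun A t)) x →
                  defined t (profile R x) ≡ multiplicity R x
defined-profile []      x = refl
defined-profile (f ∷ R) x with f x
... | just _  = cong suc (defined-profile R x)
... | nothing = defined-profile R x

separated⇒Conflict : ∀ {a} {A : Set a} {t} {R : List (PartialFun A t)} {f x y i j} →
  f ∈ R → f x ≡ just i → f y ≡ just j → i ≢ j → Conflict t (profile R x) (profile R y)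
separated⇒Conflict {R = _ ∷ R} (here refl) fx≡i fy≡j i≢j rewrite fx≡i | fy≡j = here i≢j
separated⇒Conflict {R = _ ∷ R} (there f∈R) fx≡i fy≡j i≢j = there (separated⇒Conflict f∈R fx≡i fy≡j i≢j)

module _ {a r} {A : Set a} {_⊑_ : A → A → Set r} (antisym : Antisymmetric _≡_ _⊑_)
         {t} {R : List (PartialFun A t)} (realiser : IsLocalRealiser _⊑_ R) where

  ⋢⇒Conflict : ∀ x y → ¬ (y ⊑ x) → Conflict t (profile R x) (profile R y)
  ⋢⇒Conflict x y y⋢x with proj₂ realiser x y y⋢x
  ... | _ , f∈R , _ , _ , fx≡i , fy≡j , i<j = separated⇒Conflict f∈R fx≡i fy≡j (<⇒≢ i<j)

  -- Deciding Conflict, rather than the order, makes the double-negation argument constructive.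
  ≢⇒Conflict : ∀ {x y} → x ≢ y → Conflict t (profile R x) (profile R y)
  ≢⇒Conflict {x} {y} x≢y with conflict? t (profile R x) (profile R y)
  ... | yes c  = c
  ... | no  ¬c = ⊥-elim (¬¬x⊑y λ x⊑y → ¬¬y⊑x λ y⊑x → x≢y (antisym x⊑y y⊑x))
    where
    ¬¬x⊑y : ¬ ¬ (x ⊑ y)
    ¬¬x⊑y x⋢y = ¬c (Conflict-sym t (⋢⇒Conflict y x x⋢y))
    ¬¬y⊑x : ¬ ¬ (y ⊑ x)
    ¬¬y⊑x y⋢x = ¬c (⋢⇒Conflict x y y⋢x)

theorem1 : ∀ {r : Level} (t n : ℕ) → 2 ≤ t → 1 ≤ n →
    (_⊑_ : Fin n → Fin n → Set r) → IsPartialOrder _≡_ _⊑_ →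
    (R : List (PartialFun (Fin n) t)) → IsLocalRealiser _⊑_ R →
    (k : ℕ) → (∀ x → multiplicity R x ≤ k) →
    n ≤ t ^ k
theorem1 t n (s≤s _) _ _⊑_ po R realiser k mult≤k = begin
  n                              ≡⟨ length-tabulate (profile R) ⟨
  length (tabulate (profile R))  ≤⟨ length≤t^k t (tabulate (profile R)) distinct bounded ⟩
  t ^ k                          ∎
  where
  open ≤-Reasoning
  distinct = AllPairs.tabulate⁺ (≢⇒Conflict (IsPartialOrder.antisym po) realiser)
  bounded = tabulate⁺ (λ x → ≤-trans (≤-reflexive (defined-profile R x)) (mult≤k x))
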